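{- Let $\mu$ be a $p$-core which is either empty or rectangular, $\mu=(l^a)$ with $l,a\in\mathbb{N}$, and let $w\ge 0$ be an integer. Then there exists a JS-partition $\lambda$ with $p$-core $\lambda_{(p)}=\mu$ and $p$-weight $w$.
   Context: Fix an integer $p\ge 2$. A partition is written $\lambda=(l_1^{a_1},\dots,l_t^{a_t})$ with $l_1>\dots>l_t>0$, $a_i\ge1$; $(l^a)$ denotes the partition with $a$ parts equal to $l$. It is $p$-regular if all $a_i\le p-1$. A $p$-regular $\lambda$ is a JS-partition if $l_i-l_{i+1}+a_i+a_{i+1}\equiv 0\pmod p$ for $1\le i<t$. The $p$-core $\lambda_{(p)}$ is obtained from $\lambda$ by repeatedly removing rim hooks of length $p$ until none remains; a $p$-core is a partition equal to its own $p$-core. The $p$-weight of $\lambda$ is $(|\lambda|-|\lambda_{(p)}|)/p$. -}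

module Defs where

open import Data.Nat using (ℕ; zero; suc; _+_; _*_; _∸_; _≤_; _<_; _≥_; _≟_)
open import Data.Nat.Divisibility using (_∣_)
open import Data.List using (List; []; _∷_; length)
open import Data.Nat.ListAction using (sum)
open import Data.List.Relation.Unary.All using (All)
open import Data.List.Relation.Unary.Linked using (Linked)
open import Data.Product using (_×_; _,_; ∃; ∃-syntax)
open import Data.Unit using (⊤)
open import Relation.Nullary using (¬_; yes; no)
open import Relation.Binary.PropositionalEquality using (_≡_)
open import Relation.Binary.Construct.Closure.ReflexiveTransitive using (Star)

IsPartition : List ℕ → Set
IsPartition λs = Linked _≥_ λs × All (0 <_) λs

-- i-th part (0-indexed), 0 beyond the length.
part : List ℕ → ℕ → ℕ
part []       _       = 0
part (x ∷ _)  zero    = x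
part (_ ∷ xs) (suc i) = part xs i

-- ν is obtained from λ by removing a rim hook of length p.
-- The rim hook occupies rows r..s (0-indexed, r ≤ s < length λ):
--   rows outside r..s are unchanged; for r ≤ i < s the removed cells of row i
--   are the columns λ_{i+1}, …, λ_i (so ν_i + 1 = λ_{i+1}), giving a connected
--   skew shape without 2×2 squares; in row s at least one cell is removed.
RemoveRimHook : ℕ → List ℕ → List ℕ → Set
RemoveRimHook p λs νs =
  IsPartition νs ×
  sum λs ≡ sum νs + p ×
  ∃[ r ] ∃[ s ] (r ≤ s × s < length λs ×
     (∀ i → i < r → part νs i ≡ part λs i) ×
     (∀ i → s < i → part νs i ≡ part λs i) ×
     (∀ i → r ≤ i → i < s → part νs i + 1 ≡ part λs (suc i)) ×
     part νs s < part λs s)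

IsCore : ℕ → List ℕ → Set
IsCore p μ = IsPartition μ × (∀ ν → ¬ RemoveRimHook p μ ν)

CoreOf : ℕ → List ℕ → List ℕ → Set
CoreOf p λs μ = Star (RemoveRimHook p) λs μ × IsCore p μ

HasWeight : ℕ → List ℕ → List ℕ → ℕ → Set
HasWeight p λs μ w = sum λs ≡ sum μ + w * p

-- Exponential notation (l_1^{a_1}, …, l_t^{a_t}) of a (decreasing) list of parts.
insertPart : ℕ → List (ℕ × ℕ) → List (ℕ × ℕ)
insertPart x [] = (x , 1) ∷ []
insertPart x ((y , a) ∷ r) with x ≟ y
... | yes _ = (y , suc a) ∷ r
... | no  _ = (x , 1) ∷ (y , a) ∷ r

expForm : List ℕ → List (ℕ × ℕ)
expForm []       = []
expForm (x ∷ xs) = insertPart x (expForm xs)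

IsRegular : ℕ → List ℕ → Set
IsRegular p λs = All (λ la → Data.Product.proj₂ la < p) (expForm λs)

JSCond : ℕ → List (ℕ × ℕ) → Set
JSCond p [] = ⊤
JSCond p (_ ∷ []) = ⊤
JSCond p ((l , a) ∷ (l' , a') ∷ r) = p ∣ ((l ∸ l') + a + a') × JSCond p ((l' , a') ∷ r)

IsJS : ℕ → List ℕ → Set
IsJS p λs = IsPartition λs × IsRegular p λs × JSCond p (expForm λs)

{-# OPTIONS --safe #-}
-- Write the core as a rectangle (l^a), the empty core being (0^1). A rectangle with a ≥ p rows is
-- not a p-core (the last column of its bottom p rows is a p-hook), so a < p. The partition
-- (l + 1 + (p - a) + j p, (l+1)^(a-1)) is a JS-partition, its JS sum being (j + 1) p. Removing j
-- horizontal p-hooks from its first row, and then the hook formed by the last column together with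
-- the p - a cells of the first row beyond column l + 1, leaves (l^a); so it has weight j + 1.
module Submission where

open import Defs
open import Data.Nat using (ℕ; _≥_)
open import Data.List using (List; []; replicate)
open import Data.Product using (_×_; ∃; ∃-syntax)
open import Data.Sum using (_⊎_)
open import Relation.Binary.PropositionalEquality using (_≡_)

open import Data.Nat using (zero; suc; _+_; _*_; _∸_; _≤_; _<_; z≤n; s≤s; _≟_; _<?_)
open import Data.Nat.Properties
open import Data.Nat.Divisibility using (_∣_; divides)
open import Data.Nat.ListAction using (sum)
open import Data.Nat.Tactic.RingSolver using (solve-∀)
open import Data.List using (_∷_; _++_; length)
open import Data.List.Properties using (length-replicate)
open import Data.List.Relation.Unary.All as All using (All; []; _∷_)
open import Data.List.Relation.Unary.Linked as Linked using ([]; [-]; _∷_)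
open import Data.Product using (_,_; proj₂)
open import Data.Sum using (inj₁; inj₂)
open import Data.Unit using (tt)
open import Data.Empty using (⊥-elim)
open import Relation.Nullary using (¬_; yes; no)
open import Relation.Binary.PropositionalEquality using (refl; sym; trans; cong; subst; subst₂; _≢_; module ≡-Reasoning)
open import Relation.Binary.Construct.Closure.ReflexiveTransitive using (Star; ε; _◅_)

-- The partition (l^a); it is empty when l = 0, rather than a list of zeros.
rectangle : ℕ → ℕ → List ℕ
rectangle a zero    = []
rectangle a (suc l) = replicate a (suc l)

replicate-+ : ∀ {A : Set} m n (x : A) → replicate (m + n) x ≡ replicate m x ++ replicate n x
replicate-+ zero    n x = refl
replicate-+ (suc m) n x = cong (x ∷_) (replicate-+ m n x)

part-rectangle-< : ∀ {a i} l → i < a → part (rectangle a l) i ≡ l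
part-rectangle-< zero    _ = refl
part-rectangle-< {suc a} {zero}  (suc l) _         = refl
part-rectangle-< {suc a} {suc i} (suc l) (s≤s i<a) = part-rectangle-< (suc l) i<a

part-rectangle-≥ : ∀ {a i} l → a ≤ i → part (rectangle a l) i ≡ 0
part-rectangle-≥ zero    _ = refl
part-rectangle-≥ {zero}          (suc l) _         = refl
part-rectangle-≥ {suc a} {suc i} (suc l) (s≤s a≤i) = part-rectangle-≥ (suc l) a≤i

part-rectangle-≤ : ∀ a l i → part (rectangle a l) i ≤ l
part-rectangle-≤ a zero i = z≤n
part-rectangle-≤ zero    (suc l) i       = z≤n
part-rectangle-≤ (suc a) (suc l) zero    = ≤-refl
part-rectangle-≤ (suc a) (suc l) (suc i) = part-rectangle-≤ a (suc l) i

sum-rectangle : ∀ a l → sum (rectangle a l) ≡ a * l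
sum-rectangle a       zero    = sym (*-zeroʳ a)
sum-rectangle zero    (suc l) = refl
sum-rectangle (suc a) (suc l) = cong (suc l +_) (sum-rectangle a (suc l))

IsPartition-∷ : ∀ {x ys} → 0 < x → part ys 0 ≤ x → IsPartition ys → IsPartition (x ∷ ys)
IsPartition-∷ {ys = []}    0<x _   _                    = [-] , 0<x ∷ []
IsPartition-∷ {ys = _ ∷ _} 0<x y≤x (decreasing , positive) = y≤x ∷ decreasing , 0<x ∷ positive

IsPartition-tail : ∀ {x ys} → IsPartition (x ∷ ys) → IsPartition ys
IsPartition-tail (decreasing , positive) = Linked.tail decreasing , All.tail positive

rectangle-isPartition : ∀ a l → IsPartition (rectangle a l)
rectangle-isPartition a       zero    = [] , []
rectangle-isPartition zero    (suc l) = [] , []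
rectangle-isPartition (suc a) (suc l) =
  IsPartition-∷ (s≤s z≤n) (part-rectangle-≤ a (suc l) 0) (rectangle-isPartition a (suc l))

replicate-++-isPartition : ∀ o {x ys} → 0 < x → part ys 0 ≤ x → IsPartition ys →
  IsPartition (replicate o x ++ ys)
replicate-++-isPartition zero          0<x y≤x ys-partition = ys-partition
replicate-++-isPartition (suc zero)    0<x y≤x ys-partition = IsPartition-∷ 0<x y≤x ys-partition
replicate-++-isPartition (suc (suc o)) 0<x y≤x ys-partition =
  IsPartition-∷ 0<x ≤-refl (replicate-++-isPartition (suc o) 0<x y≤x ys-partition)

RemoveRimHook-∷ : ∀ {p x λs νs} → IsPartition (x ∷ νs) →
  RemoveRimHook p λs νs → RemoveRimHook p (x ∷ λs) (x ∷ νs)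
RemoveRimHook-∷ {p} {x} {λs} {νs} xνs (_ , |λ|≡|ν|+p , r , s , r≤s , s<len , above , below , inside , last) =
  xνs , |xλ|≡|xν|+p , suc r , suc s , s≤s r≤s , s≤s s<len , above′ , below′ , inside′ , last
  where
  |xλ|≡|xν|+p : x + sum λs ≡ (x + sum νs) + p
  |xλ|≡|xν|+p = trans (cong (x +_) |λ|≡|ν|+p) (sym (+-assoc x (sum νs) p))
  above′ : ∀ i → i < suc r → part (x ∷ νs) i ≡ part (x ∷ λs) i
  above′ zero    _         = refl
  above′ (suc i) (s≤s i<r) = above i i<r
  below′ : ∀ i → suc s < i → part (x ∷ νs) i ≡ part (x ∷ λs) i
  below′ (suc i) (s≤s s<i) = below i s<i
  inside′ : ∀ i → suc r ≤ i → i < suc s → part (x ∷ νs) i + 1 ≡ part (x ∷ λs) (suc i)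
  inside′ (suc i) (s≤s r≤i) (s≤s i<s) = inside i r≤i i<s

RemoveRimHook-++ : ∀ {p} xs {λs νs} → IsPartition (xs ++ νs) →
  RemoveRimHook p λs νs → RemoveRimHook p (xs ++ λs) (xs ++ νs)
RemoveRimHook-++ []       _      hook = hook
RemoveRimHook-++ (x ∷ xs) xsνs hook =
  RemoveRimHook-∷ xsνs (RemoveRimHook-++ xs (IsPartition-tail xsνs) hook)

RemoveRimHook-firstRow : ∀ {p x xs} → 0 < p → IsPartition (x ∷ xs) →
  RemoveRimHook p (p + x ∷ xs) (x ∷ xs)
RemoveRimHook-firstRow {p} {x} {xs} 0<p xxs =
  xxs , |λ|≡|ν|+p , 0 , 0 , z≤n , s≤s z≤n , (λ _ ()) , below , (λ _ _ ()) , m<n+m x 0<p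
  where
  |λ|≡|ν|+p : (p + x) + sum xs ≡ (x + sum xs) + p
  |λ|≡|ν|+p = trans (+-assoc p x (sum xs)) (+-comm p (x + sum xs))
  below : ∀ i → 0 < i → part (x ∷ xs) i ≡ part (p + x ∷ xs) i
  below (suc i) _ = refl

RemoveRimHook-lastColumn : ∀ k b l →
  RemoveRimHook (k + suc b) (k + suc l ∷ replicate b (suc l)) (rectangle (suc b) l)
RemoveRimHook-lastColumn k b l =
  rectangle-isPartition (suc b) l , |λ|≡|ν|+p , 0 , b , z≤n , s<len , (λ _ ()) , below , inside , last b
  where
  |λ|≡|ν|+p : (k + suc l) + sum (replicate b (suc l)) ≡ sum (rectangle (suc b) l) + (k + suc b)
  |λ|≡|ν|+p rewrite sum-rectangle b (suc l) | sum-rectangle (suc b) l = identity k b l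
    where
    identity : ∀ k b l → (k + suc l) + b * suc l ≡ suc b * l + (k + suc b)
    identity = solve-∀
  s<len : b < suc (length (replicate b (suc l)))
  s<len = s≤s (≤-reflexive (sym (length-replicate b)))
  below : ∀ i → b < i → part (rectangle (suc b) l) i ≡ part (k + suc l ∷ replicate b (suc l)) i
  below (suc i) (s≤s b≤i) = trans (part-rectangle-≥ l (s≤s b≤i)) (sym (part-rectangle-≥ (suc l) b≤i))
  inside : ∀ i → 0 ≤ i → i < b → part (rectangle (suc b) l) i + 1 ≡ part (replicate b (suc l)) i
  inside i _ i<b = begin
    part (rectangle (suc b) l) i + 1 ≡⟨ cong (_+ 1) (part-rectangle-< l (m<n⇒m<1+n i<b)) ⟩
    l + 1                            ≡⟨ +-comm l 1 ⟩
    suc l                            ≡⟨ sym (part-rectangle-< (suc l) i<b) ⟩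
    part (replicate b (suc l)) i     ∎
    where open ≡-Reasoning
  last : ∀ n → part (rectangle (suc n) l) n < part (k + suc l ∷ replicate n (suc l)) n
  last zero    = subst (_< k + suc l) (sym (part-rectangle-< l (s≤s z≤n))) (m≤n+m (suc l) k)
  last (suc n) = subst₂ _<_ (sym (part-rectangle-< l (n<1+n (suc n))))
                            (sym (part-rectangle-< (suc l) (n<1+n n))) (n<1+n l)

replicate-notCore : ∀ {p a} m → 0 < p → p ≤ a → ¬ IsCore p (replicate a (suc m))
replicate-notCore {suc b} {a} m _ p≤a (_ , noHook) =
  noHook shorter (subst (λ λs → RemoveRimHook (suc b) λs shorter) tall hook)
  where
  o : ℕ
  o = a ∸ suc b
  shorter : List ℕ
  shorter = replicate o (suc m) ++ rectangle (suc b) m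
  tall : replicate o (suc m) ++ replicate (suc b) (suc m) ≡ replicate a (suc m)
  tall = trans (sym (replicate-+ o (suc b) (suc m))) (cong (λ n → replicate n (suc m)) (m∸n+n≡m p≤a))
  hook : RemoveRimHook (suc b) (replicate o (suc m) ++ replicate (suc b) (suc m)) shorter
  hook = RemoveRimHook-++ (replicate o (suc m))
    (replicate-++-isPartition o (s≤s z≤n) (m≤n⇒m≤1+n (part-rectangle-≤ (suc b) m 0))
                                (rectangle-isPartition (suc b) m))
    (RemoveRimHook-lastColumn 0 b m)

hookChain : ∀ {p} (f : ℕ → List ℕ) → (∀ j → RemoveRimHook p (f (suc j)) (f j)) →
  ∀ w → Star (RemoveRimHook p) (f w) (f 0) × HasWeight p (f w) (f 0) w
hookChain f hook zero = ε , sym (+-identityʳ _)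
hookChain {p} f hook (suc w) with hook w | hookChain f hook w
... | (_ , |λ|≡|ν|+p , _) | chain , weight = hook w ◅ chain , grows
  where
  open ≡-Reasoning
  grows : sum (f (suc w)) ≡ sum (f 0) + suc w * p
  grows = begin
    sum (f (suc w))             ≡⟨ |λ|≡|ν|+p ⟩
    sum (f w) + p               ≡⟨ cong (_+ p) weight ⟩
    (sum (f 0) + w * p) + p     ≡⟨ +-assoc (sum (f 0)) (w * p) p ⟩
    sum (f 0) + (w * p + p)     ≡⟨ cong (sum (f 0) +_) (+-comm (w * p) p) ⟩
    sum (f 0) + suc w * p       ∎

insertPart-same : ∀ x a r → insertPart x ((x , a) ∷ r) ≡ (x , suc a) ∷ r
insertPart-same x a r with x ≟ x
... | yes _  = refl
... | no x≢x = ⊥-elim (x≢x refl)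

insertPart-new : ∀ {x y} a r → x ≢ y → insertPart x ((y , a) ∷ r) ≡ (x , 1) ∷ (y , a) ∷ r
insertPart-new {x} {y} a r x≢y with x ≟ y
... | yes x≡y = ⊥-elim (x≢y x≡y)
... | no _    = refl

expForm-replicate : ∀ n x → expForm (replicate (suc n) x) ≡ (x , suc n) ∷ []
expForm-replicate zero    x = refl
expForm-replicate (suc n) x = trans (cong (insertPart x) (expForm-replicate n x)) (insertPart-same x (suc n) [])

IsJS-viaExpForm : ∀ {p λs E} → expForm λs ≡ E → IsPartition λs →
  All (λ la → proj₂ la < p) E → JSCond p E → IsJS p λs
IsJS-viaExpForm refl partition regular js = partition , regular , js

rectangle-isJS : ∀ {p} a l → a < p → IsJS p (rectangle a l)
rectangle-isJS a       zero    _   = ([] , []) , [] , tt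
rectangle-isJS zero    (suc l) _   = ([] , []) , [] , tt
rectangle-isJS (suc n) (suc l) a<p =
  IsJS-viaExpForm (expForm-replicate n (suc l)) (rectangle-isPartition (suc n) (suc l)) (a<p ∷ []) tt

twoBlock-isPartition : ∀ {x} b y → suc y < x → IsPartition (x ∷ replicate b (suc y))
twoBlock-isPartition b y y<x = IsPartition-∷ (≤-trans (s≤s z≤n) y<x)
  (≤-trans (part-rectangle-≤ b (suc y) 0) (<⇒≤ y<x)) (rectangle-isPartition b (suc y))

twoBlock-isJS : ∀ {p x} b y → suc y < x → 1 < p → b < p → p ∣ (x ∸ suc y) + 1 + b →
  IsJS p (x ∷ replicate b (suc y))
twoBlock-isJS zero    y y<x 1<p _ _ =
  IsJS-viaExpForm refl (twoBlock-isPartition zero y y<x) (1<p ∷ []) tt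
twoBlock-isJS {x = x} (suc n) y y<x 1<p b<p p∣ =
  IsJS-viaExpForm expForm≡ (twoBlock-isPartition (suc n) y y<x) (1<p ∷ b<p ∷ []) (p∣ , tt)
  where
  expForm≡ : expForm (x ∷ replicate (suc n) (suc y)) ≡ (x , 1) ∷ (suc y , suc n) ∷ []
  expForm≡ = trans (cong (insertPart x) (expForm-replicate n (suc y))) (insertPart-new (suc n) [] (>⇒≢ y<x))

-- The core (l^a) with a = b + 1 rows, and p = k + 1 + a.
module RectangularCore (k b l : ℕ) where

  p : ℕ
  p = suc k + suc b

  jsPartition : ℕ → List ℕ
  jsPartition zero    = rectangle (suc b) l
  jsPartition (suc j) = j * p + (suc k + suc l) ∷ replicate b (suc l)

  private
    a<p : suc b < p
    a<p = s≤s (m≤n+m (suc b) k)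

    l<head : ∀ j → suc l < j * p + (suc k + suc l)
    l<head j = ≤-trans (s≤s (m≤n+m (suc l) k)) (m≤n+m (suc k + suc l) (j * p))

    p∣jsSum : ∀ j → p ∣ (j * p + (suc k + suc l) ∸ suc l) + 1 + b
    p∣jsSum j = divides (suc j) (begin
      (j * p + (suc k + suc l) ∸ suc l) + 1 + b
        ≡⟨ cong (λ n → (n ∸ suc l) + 1 + b) (sym (+-assoc (j * p) (suc k) (suc l))) ⟩
      (j * p + suc k + suc l ∸ suc l) + 1 + b   ≡⟨ cong (λ n → n + 1 + b) (m+n∸n≡m (j * p + suc k) (suc l)) ⟩
      j * p + suc k + 1 + b                     ≡⟨ identity j k b ⟩
      suc j * p                                 ∎)
      where
      open ≡-Reasoning
      identity : ∀ j k b → j * (suc k + suc b) + suc k + 1 + b ≡ suc j * (suc k + suc b)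
      identity = solve-∀

  jsPartition-isJS : ∀ j → IsJS p (jsPartition j)
  jsPartition-isJS zero    = rectangle-isJS (suc b) l a<p
  jsPartition-isJS (suc j) = twoBlock-isJS b l (l<head j)
    (≤-trans (s≤s (s≤s z≤n)) a<p) (<-trans (n<1+n b) a<p) (p∣jsSum j)

  jsPartition-hook : ∀ j → RemoveRimHook p (jsPartition (suc j)) (jsPartition j)
  jsPartition-hook zero    = RemoveRimHook-lastColumn (suc k) b l
  jsPartition-hook (suc j) =
    subst (λ x → RemoveRimHook p (x ∷ replicate b (suc l)) (jsPartition (suc j)))
          (sym (+-assoc p (j * p) (suc k + suc l)))
          (RemoveRimHook-firstRow (s≤s z≤n) (twoBlock-isPartition b l (l<head j)))

rectangularCore-dimensions : ∀ {p μ} → 2 ≤ p → IsCore p μ → (μ ≡ [] ⊎ ∃[ l ] ∃[ a ] μ ≡ replicate a l) →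
  ∃[ k ] ∃[ b ] ∃[ l ] (suc k + suc b ≡ p × μ ≡ rectangle (suc b) l)
rectangularCore-dimensions {suc zero} (s≤s ()) _ _
rectangularCore-dimensions {suc (suc c)} _ _ (inj₁ refl)              = c , 0 , 0 , +-comm (suc c) 1 , refl
rectangularCore-dimensions {suc (suc c)} _ _ (inj₂ (_ , zero , refl)) = c , 0 , 0 , +-comm (suc c) 1 , refl
rectangularCore-dimensions _ ((_ , () ∷ _) , _) (inj₂ (zero , suc a , refl))
rectangularCore-dimensions {p} 2≤p core (inj₂ (suc m , suc b , refl)) with suc b <? p
... | yes a<p = p ∸ suc (suc b) , b , suc m ,
                trans (sym (+-suc (p ∸ suc (suc b)) (suc b))) (m∸n+n≡m a<p) , refl
... | no  a≮p = ⊥-elim (replicate-notCore m (≤-trans (s≤s z≤n) 2≤p) (≮⇒≥ a≮p) core)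

proposition3p7 : (p : ℕ) → p ≥ 2 → (μ : List ℕ) → IsCore p μ →
    (μ ≡ [] ⊎ ∃[ l ] ∃[ a ] μ ≡ replicate a l) → (w : ℕ) →
    ∃[ λs ] (IsJS p λs × CoreOf p λs μ × HasWeight p λs μ w)
proposition3p7 p 2≤p μ core shape w with rectangularCore-dimensions 2≤p core shape
... | k , b , l , refl , refl =
  let open RectangularCore k b l
      hooks , weight = hookChain jsPartition jsPartition-hook w
  in jsPartition w , jsPartition-isJS w , (hooks , core) , weight
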